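{- No graph in $\mathcal{F}_4$ is a contact $B_0$-VPG graph.
   Context: A graph $G$ is contact $B_0$-VPG if there is a collection of nontrivial horizontal and vertical segments on a grid, pairwise interiorly disjoint, in one-to-one correspondence with $V(G)$, such that two vertices are adjacent iff their segments share a grid point that is an endpoint of at least one of them. $\mathcal{F}_4$ is the family of graphs obtained from an induced cycle $v_1\dots v_k$ with $k\ge5$ odd (indices modulo $k$) and integers $t_i\in\{0,1,2\}$ by attaching $t_i$ new triangles to each $v_i$ (the vertices of each new triangle pairwise adjacent, adjacent to $v_i$, and adjacent to nothing else), where at least one $t_i=2$, and for every pair of indices $i,j$ (possibly $i=j$) with $t_i=t_j=2$ such that no index strictly between them cyclically (among $i+1,\dots,j-1$; all other indices when $i=j$) has $t=2$, exactly one index $m$ strictly between them has $t_m=0$. -}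

module Defs where

open import Data.Nat as ℕ using (ℕ; zero; suc; _+_; _*_; _≤_; _<_; NonZero)
open import Data.Nat.DivMod using (_%_)
open import Data.Fin using (Fin; toℕ)
open import Data.Integer as ℤ using (ℤ)
open import Data.Rational as ℚ using (ℚ)
open import Data.Product using (Σ; ∃; ∃-syntax; _×_; _,_)
open import Data.Sum using (_⊎_)
open import Relation.Binary.PropositionalEquality using (_≡_; _≢_)
open import Relation.Nullary using (¬_)
open import Function.Bundles using (_⇔_)

GridPoint : Set
GridPoint = ℤ × ℤ

-- Points of the plane (rational coordinates suffice to detect
-- intersections of interiors of grid segments).
Point : Set
Point = ℚ × ℚ

embed : GridPoint → Point
embed (a , b) = (a ℚ./ 1 , b ℚ./ 1)

record Segment : Set where
  constructor mkSeg
  field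
    p q      : GridPoint
    aligned  : (Data.Product.proj₂ p ≡ Data.Product.proj₂ q × Data.Product.proj₁ p ℤ.< Data.Product.proj₁ q)
             ⊎ (Data.Product.proj₁ p ≡ Data.Product.proj₁ q × Data.Product.proj₂ p ℤ.< Data.Product.proj₂ q)
open Segment public

OnSeg : Point → Segment → Set
OnSeg (x , y) s =
  let (a , b) = embed (p s) ; (c , d) = embed (q s) in
  (a ℚ.≤ x × x ℚ.≤ c) × (b ℚ.≤ y × y ℚ.≤ d)

Interior : Point → Segment → Set
Interior x s = OnSeg x s × x ≢ embed (p s) × x ≢ embed (q s)

InteriorlyDisjoint : Segment → Segment → Set
InteriorlyDisjoint s s′ = ¬ (∃[ x ] (Interior x s × Interior x s′))

IsEndpoint : GridPoint → Segment → Set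
IsEndpoint g s = g ≡ p s ⊎ g ≡ q s

Contact : Segment → Segment → Set
Contact s s′ = ∃[ g ] (OnSeg (embed g) s × OnSeg (embed g) s′
                       × (IsEndpoint g s ⊎ IsEndpoint g s′))

ContactB0VPG : (V : Set) → (V → V → Set) → Set
ContactB0VPG V Adj =
  Σ (V → Segment) λ seg →
      (∀ u v → seg u ≡ seg v → u ≡ v)
    × (∀ u v → u ≢ v → InteriorlyDisjoint (seg u) (seg v))
    × (∀ u v → u ≢ v → (Adj u v ⇔ Contact (seg u) (seg v)))

-- Vertices: cycle vertices v_i, and vertex b ∈ Fin 3 of the a-th triangle
-- attached to v_i (a < t i).
data F4Vertex (k : ℕ) (t : Fin k → ℕ) : Set where
  cyc : Fin k → F4Vertex k t
  tri : (i : Fin k) → Fin (t i) → Fin 3 → F4Vertex k t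

CycSucc : (k : ℕ) → Fin k → Fin k → Set
CycSucc k i j = suc (toℕ i) ≡ toℕ j ⊎ (suc (toℕ i) ≡ k × toℕ j ≡ 0)

F4Adj : (k : ℕ) (t : Fin k → ℕ) → F4Vertex k t → F4Vertex k t → Set
F4Adj k t (cyc i) (cyc j) = CycSucc k i j ⊎ CycSucc k j i
F4Adj k t (cyc i) (tri j a b) = i ≡ j
F4Adj k t (tri i a b) (cyc j) = i ≡ j
F4Adj k t (tri i a b) (tri j a′ b′) = i ≡ j × toℕ a ≡ toℕ a′ × b ≢ b′

-- m is strictly between i and j cyclically (i+1, …, j-1 mod k; all indices
-- other than i when i = j): d ∈ [1,k] is the forward distance from i to j.
StrictlyBetween : (k : ℕ) .{{_ : NonZero k}} → Fin k → Fin k → Fin k → Set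
StrictlyBetween k i j m =
  ∃[ s ] ∃[ d ] (1 ≤ s × s < d × d ≤ k
                × (toℕ i + d) % k ≡ toℕ j × (toℕ i + s) % k ≡ toℕ m)

Odd : ℕ → Set
Odd k = ∃[ r ] k ≡ suc (2 * r)

InF4 : (k : ℕ) .{{_ : NonZero k}} → (Fin k → ℕ) → Set
InF4 k t =
    5 ≤ k × Odd k
  × (∀ i → t i ≤ 2)
  × (∃[ i ] t i ≡ 2)
  × (∀ i j → t i ≡ 2 → t j ≡ 2
       → (∀ m → StrictlyBetween k i j m → ¬ (t m ≡ 2))
       → ∃[ m ] (StrictlyBetween k i j m × t m ≡ 0
                 × (∀ m′ → StrictlyBetween k i j m′ → t m′ ≡ 0 → m′ ≡ m)))

-- Each triangle attached to v_i forms a K4 with v_i, and in a contact representation of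
-- K4 by interiorly disjoint grid segments some point is an endpoint both of the segment
-- of v_i and of a segment of the triangle. These points are distinct for distinct
-- triangles and differ from the contact points of v_i with its cycle neighbours. Since a
-- segment has two endpoints, a vertex with two triangles gives no endpoint to its cycle
-- edges, and one with a triangle gives an endpoint to at most one of them. Between two
-- consecutive vertices with two triangles the unique triangle-free vertex m then splits
-- the path so that no edge before m ends the earlier segment and no edge after m ends the
-- later one; as touching parallel segments would both end at their contact point, every
-- edge of the cycle joins a horizontal and a vertical segment, impossible on an odd cycle.

module Submission where

open import Defs
open import Data.Bool using (Bool; true; false; not)
open import Data.Bool.Properties using (¬-not; not-¬; not-involutive) renaming (_≟_ to _≟ᵇ_)
open import Data.Empty using (⊥; ⊥-elim)
open import Data.Fin as Fin using (Fin; toℕ; fromℕ<; zero; suc)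
open import Data.Fin.Properties using (toℕ-injective; toℕ<n; toℕ-fromℕ<)
open import Data.Integer as ℤ using (ℤ)
import Data.Integer.Properties as ℤₚ
open import Data.Nat
open import Data.Nat.DivMod
open import Data.Nat.Divisibility using (_∣_; divides; ∣m+n∣m⇒∣n; ∣⇒≤)
open import Data.Nat.Induction using (<-rec)
open import Data.Nat.Properties
open import Data.Product using (∃-syntax; _×_; _,_; proj₁; proj₂)
open import Data.Product.Properties using (≡-dec)
import Data.Rational as ℚ
import Data.Rational.Properties as ℚₚ
import Data.Rational.Unnormalised as ℚᵘ
import Data.Rational.Unnormalised.Properties as ℚᵘₚ
open import Data.Sum using (_⊎_; inj₁; inj₂; [_,_]′)
open import Function.Bundles using (Equivalence)
open import Relation.Binary.Definitions using (tri<; tri≈; tri>)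
open import Relation.Binary.PropositionalEquality
open import Relation.Nullary using (¬_; Dec; yes; no)
open import Relation.Nullary.Decidable using (_⊎-dec_)
open import Relation.Unary using (Decidable)

*≤*⇒/≤/ : ∀ n m d e → n ℤ.* ℤ.+ suc e ℤ.≤ m ℤ.* ℤ.+ suc d → n ℚ./ suc d ℚ.≤ m ℚ./ suc e
*≤*⇒/≤/ n m d e h = ℚₚ.toℚᵘ-cancel-≤
  (ℚᵘₚ.≤-respʳ-≃ (ℚᵘₚ.≃-sym (ℚₚ.toℚᵘ-fromℚᵘ (ℚᵘ.mkℚᵘ m e)))
    (ℚᵘₚ.≤-respˡ-≃ (ℚᵘₚ.≃-sym (ℚₚ.toℚᵘ-fromℚᵘ (ℚᵘ.mkℚᵘ n d))) (ℚᵘ.*≤* h)))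

/≤/⇒*≤* : ∀ n m d e → n ℚ./ suc d ℚ.≤ m ℚ./ suc e → n ℤ.* ℤ.+ suc e ℤ.≤ m ℤ.* ℤ.+ suc d
/≤/⇒*≤* n m d e h with ℚᵘₚ.≤-respʳ-≃ (ℚₚ.toℚᵘ-fromℚᵘ (ℚᵘ.mkℚᵘ m e))
    (ℚᵘₚ.≤-respˡ-≃ (ℚₚ.toℚᵘ-fromℚᵘ (ℚᵘ.mkℚᵘ n d)) (ℚₚ.toℚᵘ-mono-≤ h))
... | ℚᵘ.*≤* n*e≤m*d = n*e≤m*d

/≡/⇒*≡* : ∀ n m d e → n ℚ./ suc d ≡ m ℚ./ suc e → n ℤ.* ℤ.+ suc e ≡ m ℤ.* ℤ.+ suc d
/≡/⇒*≡* n m d e h with ℚₚ./-injective-≃ (ℚᵘ.mkℚᵘ n d) (ℚᵘ.mkℚᵘ m e) h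
... | ℚᵘ.*≡* n*e≡m*d = n*e≡m*d

/1-mono-≤ : ∀ {a b} → a ℤ.≤ b → a ℚ./ 1 ℚ.≤ b ℚ./ 1
/1-mono-≤ {a} {b} h =
  *≤*⇒/≤/ a b 0 0 (subst₂ ℤ._≤_ (sym (ℤₚ.*-identityʳ a)) (sym (ℤₚ.*-identityʳ b)) h)

/1-cancel-≤ : ∀ a b → a ℚ./ 1 ℚ.≤ b ℚ./ 1 → a ℤ.≤ b
/1-cancel-≤ a b h = subst₂ ℤ._≤_ (ℤₚ.*-identityʳ a) (ℤₚ.*-identityʳ b) (/≤/⇒*≤* a b 0 0 h)

-- Grid segments in coordinates

orientation : Segment → Bool
orientation (mkSeg _ _ (inj₁ _)) = true
orientation (mkSeg _ _ (inj₂ _)) = false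

along across : Bool → GridPoint → ℤ
along true = proj₁
along false = proj₂
across true = proj₂
across false = proj₁

point : Bool → ℤ → ℤ → GridPoint
point true x y = (x , y)
point false x y = (y , x)

along-point : ∀ o x y → along o (point o x y) ≡ x
along-point true x y = refl
along-point false x y = refl

across-point : ∀ o x y → across o (point o x y) ≡ y
across-point true x y = refl
across-point false x y = refl

across-not : ∀ o g → across (not o) g ≡ along o g
across-not true g = refl
across-not false g = refl

coordinates-injective : ∀ o {g h} → along o g ≡ along o h → across o g ≡ across o h → g ≡ h
coordinates-injective true refl refl = refl
coordinates-injective false refl refl = refl

start<end : ∀ s → along (orientation s) (p s) ℤ.< along (orientation s) (q s)
start<end (mkSeg _ _ (inj₁ (_ , l))) = l
start<end (mkSeg _ _ (inj₂ (_ , l))) = l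

across-end : ∀ s → across (orientation s) (q s) ≡ across (orientation s) (p s)
across-end (mkSeg _ _ (inj₁ (e , _))) = sym e
across-end (mkSeg _ _ (inj₂ (e , _))) = sym e

start<end-at : ∀ {o} s → orientation s ≡ o → along o (p s) ℤ.< along o (q s)
start<end-at s refl = start<end s

p≢q : ∀ s → p s ≢ q s
p≢q s e = ℤₚ.<-irrefl (cong (along (orientation s)) e) (start<end s)

record OnAt (o : Bool) (g : GridPoint) (s : Segment) : Set where
  constructor on
  field
    start≤ : along o (p s) ℤ.≤ along o g
    ≤end   : along o g ℤ.≤ along o (q s)
    aligned-with-start : across o g ≡ across o (p s)
open OnAt

infix 4 _∈ₛ_
_∈ₛ_ : GridPoint → Segment → Set
g ∈ₛ s = OnAt (orientation s) g s

∈ₛ-at : ∀ {o g s} → orientation s ≡ o → g ∈ₛ s → OnAt o g s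
∈ₛ-at refl h = h

at-∈ₛ : ∀ {o g s} → orientation s ≡ o → OnAt o g s → g ∈ₛ s
at-∈ₛ refl h = h

squeeze : ∀ {a b c : ℤ} → a ℤ.≤ b → b ℤ.≤ c → a ≡ c → b ≡ a
squeeze a≤b b≤c refl = ℤₚ.≤-antisym b≤c a≤b

∈ₛ⇒OnSeg : ∀ {g s} → g ∈ₛ s → OnSeg (embed g) s
∈ₛ⇒OnSeg {x , y} {mkSeg (px , py) (qx , qy) (inj₁ (e , _))} (on px≤x x≤qx refl) =
  (/1-mono-≤ px≤x , /1-mono-≤ x≤qx) , (ℚₚ.≤-refl , /1-mono-≤ (ℤₚ.≤-reflexive e))
∈ₛ⇒OnSeg {x , y} {mkSeg (px , py) (qx , qy) (inj₂ (e , _))} (on py≤y y≤qy refl) =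
  (ℚₚ.≤-refl , /1-mono-≤ (ℤₚ.≤-reflexive e)) , (/1-mono-≤ py≤y , /1-mono-≤ y≤qy)

OnSeg⇒∈ₛ : ∀ {g s} → OnSeg (embed g) s → g ∈ₛ s
OnSeg⇒∈ₛ {x , y} {mkSeg (px , py) (qx , qy) (inj₁ (e , _))} ((h₁ , h₂) , (h₃ , h₄)) =
  on (/1-cancel-≤ px x h₁) (/1-cancel-≤ x qx h₂) (squeeze (/1-cancel-≤ py y h₃) (/1-cancel-≤ y qy h₄) e)
OnSeg⇒∈ₛ {x , y} {mkSeg (px , py) (qx , qy) (inj₂ (e , _))} ((h₁ , h₂) , (h₃ , h₄)) =
  on (/1-cancel-≤ py y h₃) (/1-cancel-≤ y qy h₄) (squeeze (/1-cancel-≤ px x h₁) (/1-cancel-≤ x qx h₂) e)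

-- Points with half-integer coordinates are given by their doubled coordinates.
half : ℤ × ℤ → Point
half (u , w) = (u ℚ./ 2 , w ℚ./ 2)

double : GridPoint → ℤ × ℤ
double (x , y) = (x ℤ.* ℤ.+ 2 , y ℤ.* ℤ.+ 2)

along-double : ∀ o g → along o (double g) ≡ along o g ℤ.* ℤ.+ 2
along-double true g = refl
along-double false g = refl

across-double : ∀ o g → across o (double g) ≡ across o g ℤ.* ℤ.+ 2
across-double true g = refl
across-double false g = refl

doubled-on-line : Bool → GridPoint → ℤ → ℤ × ℤ
doubled-on-line o g u = point o u (across o g ℤ.* ℤ.+ 2)

*2≤⇒/1≤/2 : ∀ a u → a ℤ.* ℤ.+ 2 ℤ.≤ u → a ℚ./ 1 ℚ.≤ u ℚ./ 2
*2≤⇒/1≤/2 a u h = *≤*⇒/≤/ a u 0 1 (subst (a ℤ.* ℤ.+ 2 ℤ.≤_) (sym (ℤₚ.*-identityʳ u)) h)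

≤*2⇒/2≤/1 : ∀ a u → u ℤ.≤ a ℤ.* ℤ.+ 2 → u ℚ./ 2 ℚ.≤ a ℚ./ 1
≤*2⇒/2≤/1 a u h = *≤*⇒/≤/ u a 1 0 (subst (ℤ._≤ a ℤ.* ℤ.+ 2) (sym (ℤₚ.*-identityʳ u)) h)

≢*2⇒/2≢/1 : ∀ a u → u ≢ a ℤ.* ℤ.+ 2 → u ℚ./ 2 ≢ a ℚ./ 1
≢*2⇒/2≢/1 a u h e = h (trans (sym (ℤₚ.*-identityʳ u)) (/≡/⇒*≡* u a 1 0 e))

half-interior : ∀ {o g} s h → orientation s ≡ o → OnAt o g s
              → along o (p s) ℤ.* ℤ.+ 2 ℤ.< along o h → along o h ℤ.< along o (q s) ℤ.* ℤ.+ 2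
              → across o h ≡ across o g ℤ.* ℤ.+ 2 → Interior (half h) s
half-interior (mkSeg (px , py) (qx , qy) (inj₁ (refl , _))) (u , w) refl (on _ _ refl) p<h h<q refl =
  ( (*2≤⇒/1≤/2 px u (ℤₚ.<⇒≤ p<h) , ≤*2⇒/2≤/1 qx u (ℤₚ.<⇒≤ h<q))
  , (*2≤⇒/1≤/2 py _ ℤₚ.≤-refl , ≤*2⇒/2≤/1 py _ ℤₚ.≤-refl) )
  , (λ e → ≢*2⇒/2≢/1 px u (λ u≡ → ℤₚ.<-irrefl (sym u≡) p<h) (cong proj₁ e))
  , (λ e → ≢*2⇒/2≢/1 qx u (λ u≡ → ℤₚ.<-irrefl u≡ h<q) (cong proj₁ e))
half-interior (mkSeg (px , py) (qx , qy) (inj₂ (refl , _))) (u , w) refl (on _ _ refl) p<h h<q refl =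
  ( (*2≤⇒/1≤/2 px _ ℤₚ.≤-refl , ≤*2⇒/2≤/1 px _ ℤₚ.≤-refl)
  , (*2≤⇒/1≤/2 py w (ℤₚ.<⇒≤ p<h) , ≤*2⇒/2≤/1 qy w (ℤₚ.<⇒≤ h<q)) )
  , (λ e → ≢*2⇒/2≢/1 py w (λ w≡ → ℤₚ.<-irrefl (sym w≡) p<h) (cong proj₂ e))
  , (λ e → ≢*2⇒/2≢/1 qy w (λ w≡ → ℤₚ.<-irrefl w≡ h<q) (cong proj₂ e))

*2-mono-< : ∀ {a b} → a ℤ.< b → a ℤ.* ℤ.+ 2 ℤ.< b ℤ.* ℤ.+ 2
*2-mono-< = ℤₚ.*-monoʳ-<-pos (ℤ.+ 2)

≤⇒*2<1+*2 : ∀ {a b} → a ℤ.≤ b → a ℤ.* ℤ.+ 2 ℤ.< ℤ.suc (b ℤ.* ℤ.+ 2)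
≤⇒*2<1+*2 a≤b = ℤₚ.suc[i]≤j⇒i<j (ℤₚ.suc-mono (ℤₚ.*-monoʳ-≤-nonNeg (ℤ.+ 2) a≤b))

<⇒1+*2<*2 : ∀ {a b} → a ℤ.< b → ℤ.suc (a ℤ.* ℤ.+ 2) ℤ.< b ℤ.* ℤ.+ 2
<⇒1+*2<*2 {a} {b} a<b = ℤₚ.suc[i]≤j⇒i<j
  (subst (ℤ._≤ b ℤ.* ℤ.+ 2) 1+a*2≡ (ℤₚ.*-monoʳ-≤-nonNeg (ℤ.+ 2) (ℤₚ.i<j⇒suc[i]≤j a<b)))
  where
  1+a*2≡ : ℤ.suc a ℤ.* ℤ.+ 2 ≡ ℤ.suc (ℤ.suc (a ℤ.* ℤ.+ 2))
  1+a*2≡ = trans (ℤₚ.suc-* a (ℤ.+ 2)) (ℤₚ.+-assoc (ℤ.+ 1) (ℤ.+ 1) (a ℤ.* ℤ.+ 2))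

non-endpoint-interior : ∀ {g} s → g ∈ₛ s → ¬ IsEndpoint g s → Interior (half (double g)) s
non-endpoint-interior {g} s g∈s@(on p≤g g≤q g-across) g-inner =
  half-interior s (double g) refl g∈s
    (subst (_ ℤ.<_) (sym (along-double o g)) (*2-mono-< p<g))
    (subst (ℤ._< _) (sym (along-double o g)) (*2-mono-< g<q))
    (across-double o g)
  where
  o : Bool
  o = orientation s
  p<g : along o (p s) ℤ.< along o g
  p<g = ℤₚ.≤∧≢⇒< p≤g (λ e → g-inner (inj₁ (coordinates-injective o (sym e) g-across)))
  g<q : along o g ℤ.< along o (q s)
  g<q = ℤₚ.≤∧≢⇒< g≤q λ e →
    g-inner (inj₂ (coordinates-injective o e (trans g-across (sym (across-end s)))))

interior-after : ∀ {o g} s → orientation s ≡ o → OnAt o g s → along o g ℤ.< along o (q s)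
               → Interior (half (doubled-on-line o g (ℤ.suc (along o g ℤ.* ℤ.+ 2)))) s
interior-after {o} {g} s o≡ g∈s@(on p≤g _ _) g<q =
  half-interior s (doubled-on-line o g _) o≡ g∈s
    (subst (_ ℤ.<_) (sym (along-point o _ _)) (≤⇒*2<1+*2 p≤g))
    (subst (ℤ._< _) (sym (along-point o _ _)) (<⇒1+*2<*2 g<q))
    (across-point o _ _)

interior-before : ∀ {o g} s → orientation s ≡ o → OnAt o g s → along o (p s) ℤ.< along o g
                → Interior (half (doubled-on-line o g (ℤ.suc (ℤ.pred (along o g) ℤ.* ℤ.+ 2)))) s
interior-before {o} {g} s o≡ g∈s@(on _ g≤q _) p<g =
  half-interior s (doubled-on-line o g _) o≡ g∈s
    (subst (_ ℤ.<_) (sym (along-point o _ _)) (≤⇒*2<1+*2 (ℤₚ.i<j⇒i≤pred[j] p<g)))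
    (subst (ℤ._< _) (sym (along-point o _ _))
      (<⇒1+*2<*2 (ℤₚ.<-≤-trans (ℤₚ.i≤pred[j]⇒i<j ℤₚ.≤-refl) g≤q)))
    (across-point o _ _)

same-line : ∀ {o g h s} → OnAt o g s → OnAt o h s → across o g ≡ across o h
same-line (on _ _ g-across) (on _ _ h-across) = trans g-across (sym h-across)

along-on-perpendicular : ∀ {o g s} → orientation s ≡ not o → g ∈ₛ s → along o g ≡ across (not o) (p s)
along-on-perpendicular {o} {g} o≡ g∈s =
  trans (sym (across-not o g)) (aligned-with-start (∈ₛ-at o≡ g∈s))

perpendicular-meet-once : ∀ {s s′ g g′} → orientation s′ ≡ not (orientation s)
                        → g ∈ₛ s → g ∈ₛ s′ → g′ ∈ₛ s → g′ ∈ₛ s′ → g ≡ g′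
perpendicular-meet-once {s} o≡ g∈s g∈s′ g′∈s g′∈s′ = coordinates-injective (orientation s)
  (trans (along-on-perpendicular o≡ g∈s′) (sym (along-on-perpendicular o≡ g′∈s′)))
  (same-line g∈s g′∈s)

-- Interiorly disjoint and touching segments

_≟ₚ_ : (g h : GridPoint) → Dec (g ≡ h)
_≟ₚ_ = ≡-dec ℤ._≟_ ℤ._≟_

endpoint? : ∀ g s → Dec (IsEndpoint g s)
endpoint? g s = (g ≟ₚ p s) ⊎-dec (g ≟ₚ q s)

module _ {s s′ : Segment} (disjoint : InteriorlyDisjoint s s′) where

  private
    o : Bool
    o = orientation s

  shared-point-endpoint : ∀ {g} → g ∈ₛ s → g ∈ₛ s′ → IsEndpoint g s ⊎ IsEndpoint g s′
  shared-point-endpoint {g} g∈s g∈s′ with endpoint? g s | endpoint? g s′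
  ... | yes g-end | _ = inj₁ g-end
  ... | no _ | yes g-end′ = inj₂ g-end′
  ... | no g-inner | no g-inner′ = ⊥-elim (disjoint (half (double g)
        , non-endpoint-interior s g∈s g-inner , non-endpoint-interior s′ g∈s′ g-inner′))

  module _ (parallel : orientation s ≡ orientation s′) where

    parallel-start⇒end : ∀ {g} → g ∈ₛ s → g ∈ₛ s′ → g ≡ p s′ → g ≡ q s
    parallel-start⇒end {g} g∈s@(on _ g≤q g-across) g∈s′ refl
      with along o g ℤ.≟ along o (q s)
    ... | yes g≡q = coordinates-injective o g≡q (trans g-across (sym (across-end s)))
    ... | no g≢q = ⊥-elim (disjoint (_ , interior-after s refl g∈s (ℤₚ.≤∧≢⇒< g≤q g≢q)
                                       , interior-after s′ (sym parallel) (∈ₛ-at (sym parallel) g∈s′)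
                                           (start<end-at s′ (sym parallel))))

    parallel-end⇒start : ∀ {g} → g ∈ₛ s → g ∈ₛ s′ → g ≡ q s′ → g ≡ p s
    parallel-end⇒start {g} g∈s@(on p≤g _ g-across) g∈s′ refl
      with along o (p s) ℤ.≟ along o g
    ... | yes p≡g = coordinates-injective o (sym p≡g) g-across
    ... | no p≢g = ⊥-elim (disjoint (_ , interior-before s refl g∈s (ℤₚ.≤∧≢⇒< p≤g p≢g)
                                       , interior-before s′ (sym parallel) (∈ₛ-at (sym parallel) g∈s′)
                                           (start<end-at s′ (sym parallel))))

    parallel-shared-endpoint : ∀ {g} → g ∈ₛ s → g ∈ₛ s′ → IsEndpoint g s′ → IsEndpoint g s
    parallel-shared-endpoint g∈s g∈s′ (inj₁ g≡p) = inj₂ (parallel-start⇒end g∈s g∈s′ g≡p)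
    parallel-shared-endpoint g∈s g∈s′ (inj₂ g≡q) = inj₁ (parallel-end⇒start g∈s g∈s′ g≡q)

  shared-point-unique : ∀ {g g′} → g ∈ₛ s → g ∈ₛ s′ → g′ ∈ₛ s → g′ ∈ₛ s′ → g ≡ g′
  shared-point-unique {g} {g′} g∈s g∈s′ g′∈s g′∈s′ with orientation s ≟ᵇ orientation s′
  ... | no perpendicular = perpendicular-meet-once (¬-not (≢-sym perpendicular)) g∈s g∈s′ g′∈s g′∈s′
  ... | yes parallel with ℤₚ.<-cmp (along o g) (along o g′)
  ...   | tri≈ _ g≈g′ _ = coordinates-injective o g≈g′ (same-line g∈s g′∈s)
  ...   | tri< g<g′ _ _ = ⊥-elim (disjoint (_ ,
          interior-after s refl g∈s (ℤₚ.<-≤-trans g<g′ (≤end g′∈s)) ,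
          interior-after s′ (sym parallel) (∈ₛ-at (sym parallel) g∈s′)
            (ℤₚ.<-≤-trans g<g′ (≤end (∈ₛ-at (sym parallel) g′∈s′)))))
  ...   | tri> _ _ g′<g = ⊥-elim (disjoint (_ ,
          interior-after s refl g′∈s (ℤₚ.<-≤-trans g′<g (≤end g∈s)) ,
          interior-after s′ (sym parallel) (∈ₛ-at (sym parallel) g′∈s′)
            (ℤₚ.<-≤-trans g′<g (≤end (∈ₛ-at (sym parallel) g∈s′)))))

Touch : Segment → Segment → Set
Touch s s′ = ∃[ g ] (g ∈ₛ s × g ∈ₛ s′)

Meet : Segment → Segment → Segment → Set
Meet a b c = ∃[ g ] (g ∈ₛ a × g ∈ₛ b × g ∈ₛ c)

transversal-meet : ∀ {x y z g h} → orientation x ≡ orientation y → orientation z ≡ not (orientation x)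
                 → g ∈ₛ x → g ∈ₛ z → h ∈ₛ z → h ∈ₛ y → Touch x y → g ∈ₛ y
transversal-meet {x} {y} {z} {g} {h} x∥y z⟂x g∈x g∈z h∈z h∈y (f , f∈x , f∈y) =
  subst (_∈ₛ y) (sym g≡h) h∈y
  where
  o : Bool
  o = orientation x
  g≡h : g ≡ h
  g≡h = coordinates-injective o
    (trans (along-on-perpendicular z⟂x g∈z) (sym (along-on-perpendicular z⟂x h∈z)))
    (trans (same-line g∈x f∈x) (same-line (∈ₛ-at (sym x∥y) f∈y) (∈ₛ-at (sym x∥y) h∈y)))

start≤end : ∀ {o g s s′} → OnAt o g s → OnAt o g s′ → along o (p s) ℤ.≤ along o (q s′)
start≤end (on p≤g _ _) (on _ g≤q _) = ℤₚ.≤-trans p≤g g≤q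

start≤end-at : ∀ {o} s → orientation s ≡ o → along o (p s) ℤ.≤ along o (q s)
start≤end-at s o≡ = ℤₚ.<⇒≤ (start<end-at s o≡)

-- One-dimensional Helly property: the common point is where the last segment starts.
collinear-meet : ∀ {a b c} → orientation a ≡ orientation b → orientation a ≡ orientation c
               → Touch a b → Touch b c → Touch a c → Meet a b c
collinear-meet {a} {b} {c} a∥b a∥c (gab , gab∈a , gab∈b) (gbc , gbc∈b , gbc∈c) (gac , gac∈a , gac∈c) =
  point o m (across o (p a)) ,
    on-line a refl (ℤₚ.i≤j⇒i≤j⊔k pc (ℤₚ.i≤i⊔j pa pb))
      (start≤end-at a refl) (start≤end gab∈b′ gab∈a) (start≤end gac∈c′ gac∈a) refl
  , on-line b (sym a∥b) (ℤₚ.i≤j⇒i≤j⊔k pc (ℤₚ.i≤j⊔i pa pb))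
      (start≤end gab∈a gab∈b′) (start≤end-at b (sym a∥b)) (start≤end gbc∈c′ gbc∈b′)
      (trans (sym (aligned-with-start gab∈a)) (aligned-with-start gab∈b′))
  , on-line c (sym a∥c) (ℤₚ.i≤j⊔i (pa ℤ.⊔ pb) pc)
      (start≤end gac∈a gac∈c′) (start≤end gbc∈b′ gbc∈c′) (start≤end-at c (sym a∥c))
      (trans (sym (aligned-with-start gac∈a)) (aligned-with-start gac∈c′))
  where
  o : Bool
  o = orientation a
  gab∈b′ : OnAt o gab b
  gab∈b′ = ∈ₛ-at (sym a∥b) gab∈b
  gbc∈b′ : OnAt o gbc b
  gbc∈b′ = ∈ₛ-at (sym a∥b) gbc∈b
  gbc∈c′ : OnAt o gbc c
  gbc∈c′ = ∈ₛ-at (sym a∥c) gbc∈c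
  gac∈c′ : OnAt o gac c
  gac∈c′ = ∈ₛ-at (sym a∥c) gac∈c
  pa pb pc m : ℤ
  pa = along o (p a)
  pb = along o (p b)
  pc = along o (p c)
  m = (pa ℤ.⊔ pb) ℤ.⊔ pc
  on-line : ∀ s → orientation s ≡ o → along o (p s) ℤ.≤ m
          → pa ℤ.≤ along o (q s) → pb ℤ.≤ along o (q s) → pc ℤ.≤ along o (q s)
          → across o (p a) ≡ across o (p s) → point o m (across o (p a)) ∈ₛ s
  on-line s s∥a p≤m pa≤q pb≤q pc≤q across≡ = at-∈ₛ s∥a
    (on (subst (along o (p s) ℤ.≤_) (sym (along-point o _ _)) p≤m)
        (subst (ℤ._≤ along o (q s)) (sym (along-point o _ _)) (ℤₚ.⊔-lub (ℤₚ.⊔-lub pa≤q pb≤q) pc≤q))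
        (trans (across-point o _ _) across≡))

triangle-meet : ∀ {a b c} → Touch a b → Touch b c → Touch a c → Meet a b c
triangle-meet {a} {b} {c} ab@(gab , gab∈a , gab∈b) bc@(gbc , gbc∈b , gbc∈c) ac@(gac , gac∈a , gac∈c)
  with orientation a ≟ᵇ orientation b | orientation b ≟ᵇ orientation c | orientation a ≟ᵇ orientation c
... | yes a∥b | yes b∥c | _ = collinear-meet a∥b (trans a∥b b∥c) ab bc ac
... | yes a∥b | no b∦c | _ =
  gac , gac∈a
      , transversal-meet a∥b (¬-not (λ c≡a → b∦c (trans (sym a∥b) (sym c≡a)))) gac∈a gac∈c gbc∈c gbc∈b ab
      , gac∈c
... | no a∦b | yes b∥c | _ =
  gab , gab∈a , gab∈b , transversal-meet b∥c (¬-not a∦b) gab∈b gab∈a gac∈a gac∈c bc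
... | no a∦b | no _ | yes a∥c =
  gab , gab∈a , gab∈b , transversal-meet a∥c (¬-not (≢-sym a∦b)) gab∈a gab∈b gbc∈b gbc∈c ac
... | no a∦b | no b∦c | no a∦c = ⊥-elim (a∦c (trans (¬-not a∦b) (sym (¬-not (≢-sym b∦c)))))

module PairwiseDisjoint {V : Set} (seg : V → Segment)
  (disjoint : ∀ u v → u ≢ v → InteriorlyDisjoint (seg u) (seg v)) where

  parallel-triple-through-endpoint : ∀ {b c d P} → b ≢ c → b ≢ d → c ≢ d
    → orientation (seg c) ≡ orientation (seg b) → orientation (seg d) ≡ orientation (seg b)
    → P ∈ₛ seg b → P ∈ₛ seg c → P ∈ₛ seg d → ¬ IsEndpoint P (seg b)
  parallel-triple-through-endpoint {b} {c} {d} {P} b≢c b≢d c≢d c∥b d∥b P∈b P∈c P∈d (inj₁ P≡pb) =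
    p≢q (seg c) (trans (sym (parallel-end⇒start (disjoint c d c≢d) c∥d P∈c P∈d P≡qd))
                       (parallel-start⇒end (disjoint c b (≢-sym b≢c)) c∥b P∈c P∈b P≡pb))
    where
    c∥d : orientation (seg c) ≡ orientation (seg d)
    c∥d = trans c∥b (sym d∥b)
    P≡qd : P ≡ q (seg d)
    P≡qd = parallel-start⇒end (disjoint d b (≢-sym b≢d)) d∥b P∈d P∈b P≡pb
  parallel-triple-through-endpoint {b} {c} {d} {P} b≢c b≢d c≢d c∥b d∥b P∈b P∈c P∈d (inj₂ P≡qb) =
    p≢q (seg c) (trans (sym (parallel-end⇒start (disjoint c b (≢-sym b≢c)) c∥b P∈c P∈b P≡qb))
                       (parallel-start⇒end (disjoint c d c≢d) c∥d P∈c P∈d P≡pd))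
    where
    c∥d : orientation (seg c) ≡ orientation (seg d)
    c∥d = trans c∥b (sym d∥b)
    P≡pd : P ≡ p (seg d)
    P≡pd = parallel-end⇒start (disjoint d b (≢-sym b≢d)) d∥b P∈d P∈b P≡qb

  -- If P were interior to seg a, the other three would all end at P perpendicularly to a,
  -- hence be parallel to each other.
  K4-meet-endpoint : ∀ {a b c d P} → a ≢ b → a ≢ c → a ≢ d → b ≢ c → b ≢ d → c ≢ d
    → P ∈ₛ seg a → P ∈ₛ seg b → P ∈ₛ seg c → P ∈ₛ seg d → IsEndpoint P (seg a)
  K4-meet-endpoint {a} {b} {c} {d} {P} a≢b a≢c a≢d b≢c b≢d c≢d P∈a P∈b P∈c P∈d
    with endpoint? P (seg a)
  ... | yes P-end = P-end
  ... | no P-inner = ⊥-elim (parallel-triple-through-endpoint b≢c b≢d c≢d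
          (trans (perpendicular a≢c P∈c) (sym (perpendicular a≢b P∈b)))
          (trans (perpendicular a≢d P∈d) (sym (perpendicular a≢b P∈b)))
          P∈b P∈c P∈d (ends-at-P a≢b P∈b))
    where
    ends-at-P : ∀ {x} → a ≢ x → P ∈ₛ seg x → IsEndpoint P (seg x)
    ends-at-P {x} a≢x P∈x with shared-point-endpoint (disjoint a x a≢x) P∈a P∈x
    ... | inj₁ P-end = ⊥-elim (P-inner P-end)
    ... | inj₂ P-end = P-end
    perpendicular : ∀ {x} → a ≢ x → P ∈ₛ seg x → orientation (seg x) ≡ not (orientation (seg a))
    perpendicular {x} a≢x P∈x = ¬-not λ x∥a →
      P-inner (parallel-shared-endpoint (disjoint a x a≢x) (sym x∥a) P∈a P∈x (ends-at-P a≢x P∈x))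

  K4-shared-endpoint : ∀ {a b c d} → a ≢ b → a ≢ c → a ≢ d → b ≢ c → b ≢ d → c ≢ d
    → Touch (seg a) (seg b) → Touch (seg a) (seg c)
    → Touch (seg b) (seg c) → Touch (seg b) (seg d) → Touch (seg c) (seg d)
    → ∃[ P ] (IsEndpoint P (seg a) × P ∈ₛ seg b × IsEndpoint P (seg b))
  K4-shared-endpoint {a} {b} {c} a≢b a≢c a≢d b≢c b≢d c≢d ab ac bc bd cd
    with triangle-meet bc cd bd | triangle-meet ab bc ac
  ... | P , P∈b , P∈c , P∈d | Q , Q∈a , Q∈b , Q∈c =
    P , K4-meet-endpoint a≢b a≢c a≢d b≢c b≢d c≢d P∈a P∈b P∈c P∈d
      , P∈b , K4-meet-endpoint (≢-sym a≢b) b≢c b≢d a≢c a≢d c≢d P∈b P∈a P∈c P∈d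
    where
    P∈a : P ∈ₛ seg a
    P∈a = subst (_∈ₛ _) (shared-point-unique (disjoint b c b≢c) Q∈b Q∈c P∈b P∈c) Q∈a

-- Indices modulo k

module Cyclic (k : ℕ) .{{_ : NonZero k}} where

  open ≡-Reasoning

  toℕ-mod : ∀ n → toℕ (n mod k) ≡ n % k
  toℕ-mod n = toℕ-fromℕ< (m%n<n n k)

  %-≡⇒mod-≡ : ∀ {m n} → m % k ≡ n % k → m mod k ≡ n mod k
  %-≡⇒mod-≡ {m} {n} eq = toℕ-injective (trans (toℕ-mod m) (trans eq (sym (toℕ-mod n))))

  mod-≡⇒%-≡ : ∀ {m n} → m mod k ≡ n mod k → m % k ≡ n % k
  mod-≡⇒%-≡ {m} {n} eq = trans (sym (toℕ-mod m)) (trans (cong toℕ eq) (toℕ-mod n))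

  toℕ-mod-inverse : ∀ i → toℕ i mod k ≡ i
  toℕ-mod-inverse i = toℕ-injective (trans (toℕ-mod (toℕ i)) (m<n⇒m%n≡m (toℕ<n i)))

  mod-periodic : ∀ n → (n + k) mod k ≡ n mod k
  mod-periodic n = %-≡⇒mod-≡ ([m+n]%n≡m%n n k)

  toℕ-mod-offset : ∀ n x → (toℕ (n mod k) + x) % k ≡ toℕ ((n + x) mod k)
  toℕ-mod-offset n x = begin
    (toℕ (n mod k) + x) % k        ≡⟨ cong (λ r → (r + x) % k) (toℕ-mod n) ⟩
    (n % k + x) % k                ≡⟨ %-distribˡ-+ (n % k) x k ⟩
    (n % k % k + x % k) % k        ≡⟨ cong (λ r → (r + x % k) % k) (m%n%n≡m%n n k) ⟩
    (n % k + x % k) % k            ≡⟨ %-distribˡ-+ n x k ⟨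
    (n + x) % k                    ≡⟨ toℕ-mod (n + x) ⟨
    toℕ ((n + x) mod k)            ∎

  %-+-period : ∀ n e → (n + e) % k ≡ n % k → k ∣ e
  %-+-period n e eq = ∣m+n∣m⇒∣n (divides ((n + e) / k) quotients) (divides (n / k) refl)
    where
    quotients : n / k * k + e ≡ (n + e) / k * k
    quotients = +-cancelˡ-≡ (n % k) _ _ (begin
      n % k + (n / k * k + e)      ≡⟨ +-assoc (n % k) (n / k * k) e ⟨
      n % k + n / k * k + e        ≡⟨ cong (_+ e) (m≡m%n+[m/n]*n n k) ⟨
      n + e                        ≡⟨ m≡m%n+[m/n]*n (n + e) k ⟩
      (n + e) % k + (n + e) / k * k ≡⟨ cong (_+ (n + e) / k * k) eq ⟩
      n % k + (n + e) / k * k      ∎)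

  mod-≢ : ∀ e n → 0 < e → e < k → (e + n) mod k ≢ n mod k
  mod-≢ e@(suc _) n _ e<k eq = <⇒≱ e<k
    (∣⇒≤ (%-+-period n e (trans (cong (_% k) (+-comm n e)) (mod-≡⇒%-≡ eq))))

  mod-<-window : ∀ n {u v} → 0 < u → u < v → v ≤ k → (n + u) mod k ≢ (n + v) mod k
  mod-<-window n {u} {v} 0<u u<v v≤k eq =
    mod-≢ (v ∸ u) (n + u) (m<n⇒0<n∸m u<v) (<-≤-trans (∸-monoʳ-< 0<u (<⇒≤ u<v)) v≤k)
      (trans (cong (_mod k) n+v≡) (sym eq))
    where
    n+v≡ : v ∸ u + (n + u) ≡ n + v
    n+v≡ = begin
      v ∸ u + (n + u)   ≡⟨ +-comm (v ∸ u) (n + u) ⟩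
      n + u + (v ∸ u)   ≡⟨ +-assoc n u (v ∸ u) ⟩
      n + (u + (v ∸ u)) ≡⟨ cong (n +_) (m+[n∸m]≡n (<⇒≤ u<v)) ⟩
      n + v             ∎

  mod-injective-window : ∀ n {u v} → 0 < u → 0 < v → u ≤ k → v ≤ k
                       → (n + u) mod k ≡ (n + v) mod k → u ≡ v
  mod-injective-window n {u} {v} 0<u 0<v u≤k v≤k eq with <-cmp u v
  ... | tri≈ _ u≡v _ = u≡v
  ... | tri< u<v _ _ = ⊥-elim (mod-<-window n 0<u u<v v≤k eq)
  ... | tri> _ _ v<u = ⊥-elim (mod-<-window n 0<v v<u u≤k (sym eq))

  CycSucc⇒≡ : ∀ {i j} → CycSucc k i j → j ≡ suc (toℕ i) mod k
  CycSucc⇒≡ {i} {j} (inj₁ 1+i≡j) = trans (sym (toℕ-mod-inverse j)) (cong (_mod k) (sym 1+i≡j))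
  CycSucc⇒≡ {i} {j} (inj₂ (1+i≡k , j≡0)) =
    toℕ-injective (trans j≡0 (sym (trans (toℕ-mod _) (trans (cong (_% k) 1+i≡k) (n%n≡0 k)))))

  CycSucc-suc : ∀ i → CycSucc k i (suc (toℕ i) mod k)
  CycSucc-suc i with suc (toℕ i) <? k
  ... | yes 1+i<k = inj₁ (sym (trans (toℕ-mod _) (m<n⇒m%n≡m 1+i<k)))
  ... | no 1+i≮k = inj₂ (1+i≡k , trans (toℕ-mod _) (trans (cong (_% k) 1+i≡k) (n%n≡0 k)))
    where
    1+i≡k : suc (toℕ i) ≡ k
    1+i≡k = ≤-antisym (toℕ<n i) (≮⇒≥ 1+i≮k)

  suc-mod : ∀ n → suc (toℕ (n mod k)) mod k ≡ suc n mod k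
  suc-mod n = toℕ-injective (begin
    toℕ (suc (toℕ (n mod k)) mod k) ≡⟨ toℕ-mod _ ⟩
    suc (toℕ (n mod k)) % k         ≡⟨ cong (_% k) (+-comm 1 (toℕ (n mod k))) ⟩
    (toℕ (n mod k) + 1) % k         ≡⟨ toℕ-mod-offset n 1 ⟩
    toℕ ((n + 1) mod k)             ≡⟨ cong (λ m → toℕ (m mod k)) (+-comm n 1) ⟩
    toℕ (suc n mod k)               ∎)

  CycSucc-mod : ∀ n → CycSucc k (n mod k) (suc n mod k)
  CycSucc-mod n = subst (CycSucc k (n mod k)) (suc-mod n) (CycSucc-suc (n mod k))

  StrictlyBetween⇒offset : ∀ n {d m} → 0 < d → d ≤ k → StrictlyBetween k (n mod k) ((n + d) mod k) m
                         → ∃[ s ] (0 < s × s < d × m ≡ (n + s) mod k)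
  StrictlyBetween⇒offset n {d} {m} 0<d d≤k (s , d′ , 0<s , s<d′ , d′≤k , n+d′≡ , n+s≡) =
    s , 0<s , subst (s <_) d′≡d s<d′ , toℕ-injective (trans (sym n+s≡) (toℕ-mod-offset n s))
    where
    d′≡d : d′ ≡ d
    d′≡d = mod-injective-window n (<-trans 0<s s<d′) 0<d d′≤k d≤k
      (toℕ-injective (trans (sym (toℕ-mod-offset n d′)) n+d′≡))

  offset⇒StrictlyBetween : ∀ n {s d} → 0 < s → s < d → d ≤ k
                         → StrictlyBetween k (n mod k) ((n + d) mod k) ((n + s) mod k)
  offset⇒StrictlyBetween n {s} {d} 0<s s<d d≤k =
    s , d , 0<s , s<d , d≤k , toℕ-mod-offset n d , toℕ-mod-offset n s

-- Turning along the cycle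

first-in-range : ∀ {P : ℕ → Set} → Decidable P → ∀ n
               → (∃[ m ] (m < n × P m × ∀ s → s < m → ¬ P s)) ⊎ (∀ s → s < n → ¬ P s)
first-in-range P? zero = inj₂ λ _ ()
first-in-range P? (suc n) with first-in-range P? n
... | inj₁ (m , m<n , Pm , below) = inj₁ (m , m<n⇒m<1+n m<n , Pm , below)
... | inj₂ none with P? n
...   | yes Pn = inj₁ (n , ≤-refl , Pn , none)
...   | no ¬Pn = inj₂ λ s s<1+n → [ none s , (λ { refl → ¬Pn }) ]′ (m≤n⇒m<n∨m≡n (s≤s⁻¹ s<1+n))

least-witness : ∀ {P : ℕ → Set} → Decidable P → ∀ {n} → P n
              → ∃[ m ] (m ≤ n × P m × ∀ s → s < m → ¬ P s)
least-witness P? {n} Pn with first-in-range P? n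
... | inj₁ (m , m<n , Pm , below) = m , <⇒≤ m<n , Pm , below
... | inj₂ none = n , ≤-refl , Pn , none

alternating-odd : (f : ℕ → Bool) → (∀ n → f n ≢ f (suc n)) → ∀ r → f (suc (2 * r)) ≡ not (f 0)
alternating-odd f alternating r = trans (¬-not (≢-sym (alternating (2 * r)))) (cong not (even r))
  where
  even : ∀ r → f (2 * r) ≡ f 0
  even zero = refl
  even (suc r) = begin
    f (2 * suc r)           ≡⟨ cong f (*-suc 2 r) ⟩
    f (suc (suc (2 * r)))   ≡⟨ ¬-not (≢-sym (alternating (suc (2 * r)))) ⟩
    not (f (suc (2 * r)))   ≡⟨ cong not (¬-not (≢-sym (alternating (2 * r)))) ⟩
    not (not (f (2 * r)))   ≡⟨ not-involutive _ ⟩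
    f (2 * r)               ≡⟨ even r ⟩
    f 0                     ∎
    where open ≡-Reasoning

-- Position n of the cycle carries T n triangles; edge n joins positions n and suc n, and
-- Out n and In n say that its contact point is an endpoint of the segment at n,
-- respectively at suc n.
record EndpointConstraints (T : ℕ → ℕ) (o : ℕ → Bool) (Out In : ℕ → Set) : Set where
  field
    out-or-in   : ∀ n → Out n ⊎ In n
    parallel⇒out×in : ∀ n → o n ≡ o (suc n) → Out n × In n
    two⇒¬out    : ∀ n → 2 ≤ T n → ¬ Out n
    two⇒¬in     : ∀ n → 2 ≤ T (suc n) → ¬ In n
    one⇒¬in×out : ∀ n → 1 ≤ T (suc n) → In n → ¬ Out (suc n)

  ¬out⇒in : ∀ {n} → ¬ Out n → In n
  ¬out⇒in {n} ¬out with out-or-in n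
  ... | inj₁ out = ⊥-elim (¬out out)
  ... | inj₂ in′ = in′

  ¬in⇒out : ∀ {n} → ¬ In n → Out n
  ¬in⇒out {n} ¬in with out-or-in n
  ... | inj₁ out = out
  ... | inj₂ in′ = ⊥-elim (¬in in′)

shift-constraints : ∀ {T o Out In} → EndpointConstraints T o Out In → ∀ b
  → EndpointConstraints (λ n → T (b + n)) (λ n → o (b + n)) (λ n → Out (b + n)) (λ n → In (b + n))
shift-constraints {T} {o} {Out} c b = record
  { out-or-in       = λ n → out-or-in (b + n)
  ; parallel⇒out×in = λ n o≡ → parallel⇒out×in (b + n) (trans o≡ (cong o (+-suc b n)))
  ; two⇒¬out        = λ n → two⇒¬out (b + n)
  ; two⇒¬in         = λ n 2≤T → two⇒¬in (b + n) (subst (λ m → 2 ≤ T m) (+-suc b n) 2≤T)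
  ; one⇒¬in×out     = λ n 1≤T in′ → subst (λ m → ¬ Out m) (sym (+-suc b n))
                        (one⇒¬in×out (b + n) (subst (λ m → 1 ≤ T m) (+-suc b n) 1≤T) in′)
  }
  where open EndpointConstraints c

Occupied : (ℕ → ℕ) → ℕ → ℕ → Set
Occupied T d s₀ = ∀ s → 0 < s → s < d → s ≢ s₀ → 1 ≤ T s

module _ {T o Out In} (c : EndpointConstraints T o Out In) where
  open EndpointConstraints c

  module _ {d s₀} (2≤T₀ : 2 ≤ T 0) (2≤Td : 2 ≤ T d) (occupied : Occupied T d s₀) where

    no-out-before : ∀ e → e < s₀ → e < d → ¬ Out e
    no-out-before zero _ _ = two⇒¬out 0 2≤T₀
    no-out-before (suc e) 1+e<s₀ 1+e<d =
      one⇒¬in×out e (occupied (suc e) z<s 1+e<d (<⇒≢ 1+e<s₀))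
        (¬out⇒in (no-out-before e (<-trans (n<1+n e) 1+e<s₀) (<-trans (n<1+n e) 1+e<d)))

    no-in-until : ∀ j e → suc e + j ≡ d → s₀ ≤ e → ¬ In e
    no-in-until zero e 1+e+0≡d _ =
      two⇒¬in e (subst (λ m → 2 ≤ T m) (trans (sym 1+e+0≡d) (+-identityʳ (suc e))) 2≤Td)
    no-in-until (suc j) e 1+e+1+j≡d s₀≤e in′ = one⇒¬in×out e 1≤T[1+e] in′
      (¬in⇒out (no-in-until j (suc e) 2+e+j≡d (m≤n⇒m≤1+n s₀≤e)))
      where
      2+e+j≡d : suc (suc e) + j ≡ d
      2+e+j≡d = trans (sym (+-suc (suc e) j)) 1+e+1+j≡d
      1≤T[1+e] : 1 ≤ T (suc e)
      1≤T[1+e] = occupied (suc e) z<s (subst (suc e <_) 2+e+j≡d (m≤m+n (suc (suc e)) j))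
                   (λ 1+e≡s₀ → <-irrefl (sym 1+e≡s₀) (s≤s s₀≤e))

    stretch-turns₀ : ∀ e → e < d → o e ≢ o (suc e)
    stretch-turns₀ e e<d parallel with e <? s₀
    ... | yes e<s₀ = no-out-before e e<s₀ e<d (proj₁ (parallel⇒out×in e parallel))
    ... | no e≮s₀ = no-in-until (d ∸ suc e) e (m+[n∸m]≡n e<d) (≮⇒≥ e≮s₀)
                      (proj₂ (parallel⇒out×in e parallel))

stretch-turns : ∀ {T o Out In} → EndpointConstraints T o Out In → ∀ b {d s₀}
  → 2 ≤ T b → 2 ≤ T (b + d) → Occupied (λ s → T (b + s)) d s₀
  → ∀ e → e < d → o (b + e) ≢ o (b + suc e)
stretch-turns {T} c b 2≤Tb 2≤Tbd occupied =
  stretch-turns₀ (shift-constraints c b) (subst (λ m → 2 ≤ T m) (sym (+-identityʳ b)) 2≤Tb)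
    2≤Tbd occupied

module OddCycleOfStretches (k : ℕ) .{{_ : NonZero k}} (t : Fin k → ℕ) (hF4 : InF4 k t) where

  open Cyclic k

  T : ℕ → ℕ
  T n = t (n mod k)

  NoDoubleBetween : ℕ → ℕ → Set
  NoDoubleBetween b d = ∀ s → 0 < s → s < d → T (b + s) ≢ 2

  next-double : ∀ b → T b ≡ 2 → ∃[ d ] (0 < d × d ≤ k × T (b + d) ≡ 2 × NoDoubleBetween b d)
  next-double b Tb≡2 with least-witness (λ s → T (b + suc s) ≟ 2) {pred k} T[b+k]≡2
    where
    T[b+k]≡2 : T (b + suc (pred k)) ≡ 2
    T[b+k]≡2 = trans (cong (λ n → t ((b + n) mod k)) (suc-pred k))
                     (trans (cong t (mod-periodic b)) Tb≡2)
  ... | m , m≤k-1 , T≡2 , below = suc m , z<s , m≤pred[n]⇒suc[m]≤n m≤k-1 , T≡2 , no-double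
    where
    no-double : NoDoubleBetween b (suc m)
    no-double (suc s) _ s<m = below s (s≤s⁻¹ s<m)

  single-gap : ∀ {b d} → T b ≡ 2 → 0 < d → d ≤ k → T (b + d) ≡ 2 → NoDoubleBetween b d
             → ∃[ s₀ ] Occupied (λ s → T (b + s)) d s₀
  single-gap {b} {d} Tb≡2 0<d d≤k Tbd≡2 no-double
    with proj₂ (proj₂ (proj₂ (proj₂ hF4))) (b mod k) ((b + d) mod k) Tb≡2 Tbd≡2 no-double-between
    where
    no-double-between : ∀ m → StrictlyBetween k (b mod k) ((b + d) mod k) m → ¬ (t m ≡ 2)
    no-double-between m between with StrictlyBetween⇒offset b 0<d d≤k between
    ... | s , 0<s , s<d , refl = no-double s 0<s s<d
  ... | m₀ , between₀ , tm₀≡0 , unique with StrictlyBetween⇒offset b 0<d d≤k between₀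
  ...   | s₀ , 0<s₀ , s₀<d , m₀≡ = s₀ , occupied
    where
    occupied : Occupied (λ s → T (b + s)) d s₀
    occupied s 0<s s<d s≢s₀ = n≢0⇒n>0 λ T≡0 → s≢s₀
      (mod-injective-window b 0<s 0<s₀ (<⇒≤ (<-≤-trans s<d d≤k)) (<⇒≤ (<-≤-trans s₀<d d≤k))
        (trans (unique _ (offset⇒StrictlyBetween b 0<s s<d d≤k) T≡0) m₀≡))

  module _ {o : Fin k → Bool} {Out In : ℕ → Set}
    (c : EndpointConstraints T (λ n → o (n mod k)) Out In) where

    Turns : ℕ → ℕ → Set
    Turns b e = o ((b + e) mod k) ≢ o ((b + suc e) mod k)

    turns-from-double : ∀ e b → T b ≡ 2 → Turns b e
    turns-from-double = <-rec (λ e → ∀ b → T b ≡ 2 → Turns b e) turns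
      where
      turns : ∀ e → (∀ {e′} → e′ < e → ∀ b → T b ≡ 2 → Turns b e′) → ∀ b → T b ≡ 2 → Turns b e
      turns e rec b Tb≡2 with next-double b Tb≡2
      ... | d , 0<d , d≤k , Tbd≡2 , no-double with e <? d
      ...   | yes e<d = stretch-turns c b (≤-reflexive (sym Tb≡2)) (≤-reflexive (sym Tbd≡2))
                          (proj₂ (single-gap Tb≡2 0<d d≤k Tbd≡2 no-double)) e e<d
      ...   | no e≮d = subst₂ (λ x y → o (x mod k) ≢ o (y mod k)) b+d+[e∸d]≡b+e b+d+[1+e∸d]≡b+1+e
                         (rec (∸-monoʳ-< 0<d d≤e) (b + d) Tbd≡2)
        where
        d≤e : d ≤ e
        d≤e = ≮⇒≥ e≮d
        b+d+[e∸d]≡b+e : b + d + (e ∸ d) ≡ b + e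
        b+d+[e∸d]≡b+e = trans (+-assoc b d (e ∸ d)) (cong (b +_) (m+[n∸m]≡n d≤e))
        b+d+[1+e∸d]≡b+1+e : b + d + suc (e ∸ d) ≡ b + suc e
        b+d+[1+e∸d]≡b+1+e = trans (+-suc (b + d) (e ∸ d))
                              (trans (cong suc b+d+[e∸d]≡b+e) (sym (+-suc b e)))

    odd-cycle-cannot-turn-everywhere : ⊥
    odd-cycle-cannot-turn-everywhere = absurd hF4
      where
      absurd : InF4 k t → ⊥
      absurd (_ , (r , k≡1+2r) , _ , (i₀ , ti₀≡2) , _) =
        not-¬ full-turn (subst (λ n → f n ≡ not (f 0)) (sym k≡1+2r) (alternating-odd f turns r))
        where
        b₀ : ℕ
        b₀ = toℕ i₀
        f : ℕ → Bool
        f e = o ((b₀ + e) mod k)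
        turns : ∀ e → f e ≢ f (suc e)
        turns e = turns-from-double e b₀ (trans (cong t (toℕ-mod-inverse i₀)) ti₀≡2)
        full-turn : f k ≡ f 0
        full-turn = cong o (trans (mod-periodic b₀) (cong (_mod k) (sym (+-identityʳ b₀))))

-- Contact representations of graphs in F₄

no-three-endpoints : ∀ {x y z s} → x ≢ y → x ≢ z → y ≢ z
                   → IsEndpoint x s → IsEndpoint y s → ¬ IsEndpoint z s
no-three-endpoints x≢y _ _ (inj₁ x≡p) (inj₁ y≡p) _ = x≢y (trans x≡p (sym y≡p))
no-three-endpoints x≢y _ _ (inj₂ x≡q) (inj₂ y≡q) _ = x≢y (trans x≡q (sym y≡q))
no-three-endpoints _ x≢z _ (inj₁ x≡p) (inj₂ _) (inj₁ z≡p) = x≢z (trans x≡p (sym z≡p))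
no-three-endpoints _ _ y≢z (inj₁ _) (inj₂ y≡q) (inj₂ z≡q) = y≢z (trans y≡q (sym z≡q))
no-three-endpoints _ _ y≢z (inj₂ _) (inj₁ y≡p) (inj₁ z≡p) = y≢z (trans y≡p (sym z≡p))
no-three-endpoints _ x≢z _ (inj₂ x≡q) (inj₁ _) (inj₂ z≡q) = x≢z (trans x≡q (sym z≡q))

module Realisation (k : ℕ) .{{_ : NonZero k}} (t : Fin k → ℕ) (5≤k : 5 ≤ k)
  (rep : ContactB0VPG (F4Vertex k t) (F4Adj k t)) where

  open Cyclic k

  seg : F4Vertex k t → Segment
  seg = proj₁ rep

  disjoint : ∀ u v → u ≢ v → InteriorlyDisjoint (seg u) (seg v)
  disjoint = proj₁ (proj₂ (proj₂ rep))

  open PairwiseDisjoint seg disjoint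

  adjacent⇒Contact : ∀ {u v} → u ≢ v → F4Adj k t u v → Contact (seg u) (seg v)
  adjacent⇒Contact {u} {v} u≢v = Equivalence.to (proj₂ (proj₂ (proj₂ rep)) u v u≢v)

  adjacent⇒Touch : ∀ {u v} → u ≢ v → F4Adj k t u v → Touch (seg u) (seg v)
  adjacent⇒Touch u≢v adjacent with adjacent⇒Contact u≢v adjacent
  ... | g , g∈u , g∈v , _ = g , OnSeg⇒∈ₛ g∈u , OnSeg⇒∈ₛ g∈v

  endpoint-contact⇒adjacent : ∀ {u v g} → u ≢ v → g ∈ₛ seg u → g ∈ₛ seg v
                            → IsEndpoint g (seg u) ⊎ IsEndpoint g (seg v) → F4Adj k t u v
  endpoint-contact⇒adjacent {u} {v} u≢v g∈u g∈v g-end =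
    Equivalence.from (proj₂ (proj₂ (proj₂ rep)) u v u≢v) (_ , ∈ₛ⇒OnSeg g∈u , ∈ₛ⇒OnSeg g∈v , g-end)

  shared-point⇒adjacent : ∀ {u v g} → u ≢ v → g ∈ₛ seg u → g ∈ₛ seg v → F4Adj k t u v
  shared-point⇒adjacent {u} {v} u≢v g∈u g∈v =
    endpoint-contact⇒adjacent u≢v g∈u g∈v (shared-point-endpoint (disjoint u v u≢v) g∈u g∈v)

  C : ℕ → F4Vertex k t
  C n = cyc (n mod k)

  C-≢ : ∀ e n → 0 < e → e < 5 → C (e + n) ≢ C n
  C-≢ e n 0<e e<5 eq = mod-≢ e n 0<e (<-≤-trans e<5 5≤k) (cyc-injective eq)
    where
    cyc-injective : ∀ {i j} → cyc {k} {t} i ≡ cyc j → i ≡ j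
    cyc-injective refl = refl

  C-≢-suc : ∀ n → C (suc n) ≢ C n
  C-≢-suc n = C-≢ 1 n z<s (s<s z<s)

  edge-contact : ∀ n → Contact (seg (C n)) (seg (C (suc n)))
  edge-contact n = adjacent⇒Contact (≢-sym (C-≢-suc n)) (inj₁ (CycSucc-mod n))

  contact : ℕ → GridPoint
  contact n = proj₁ (edge-contact n)

  contact∈ : ∀ n → contact n ∈ₛ seg (C n)
  contact∈ n = OnSeg⇒∈ₛ (proj₁ (proj₂ (edge-contact n)))

  contact∈suc : ∀ n → contact n ∈ₛ seg (C (suc n))
  contact∈suc n = OnSeg⇒∈ₛ (proj₁ (proj₂ (proj₂ (edge-contact n))))

  Out In : ℕ → Set
  Out n = IsEndpoint (contact n) (seg (C n))
  In n = IsEndpoint (contact n) (seg (C (suc n)))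

  triangle-K4 : ∀ m a → ∃[ P ] (IsEndpoint P (seg (cyc m)) × P ∈ₛ seg (tri m a zero)
                                × IsEndpoint P (seg (tri m a zero)))
  triangle-K4 m a = K4-shared-endpoint {c = tri m a (suc zero)} {d = tri m a (suc (suc zero))}
    (λ ()) (λ ()) (λ ()) (λ ()) (λ ()) (λ ())
    (adjacent⇒Touch (λ ()) refl) (adjacent⇒Touch (λ ()) refl)
    (adjacent⇒Touch (λ ()) (refl , refl , λ ())) (adjacent⇒Touch (λ ()) (refl , refl , λ ()))
    (adjacent⇒Touch (λ ()) (refl , refl , λ ()))

  anchor : ∀ m → Fin (t m) → GridPoint
  anchor m a = proj₁ (triangle-K4 m a)

  anchor-endpoint : ∀ m a → IsEndpoint (anchor m a) (seg (cyc m))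
  anchor-endpoint m a = proj₁ (proj₂ (triangle-K4 m a))

  anchor∈triangle : ∀ m a → anchor m a ∈ₛ seg (tri m a zero)
  anchor∈triangle m a = proj₁ (proj₂ (proj₂ (triangle-K4 m a)))

  anchor-triangle-endpoint : ∀ m a → IsEndpoint (anchor m a) (seg (tri m a zero))
  anchor-triangle-endpoint m a = proj₂ (proj₂ (proj₂ (triangle-K4 m a)))

  anchor-on-cycle : ∀ {m a i} → anchor m a ∈ₛ seg (cyc i) → i ≡ m
  anchor-on-cycle {m} {a} P∈i =
    endpoint-contact⇒adjacent (λ ()) P∈i (anchor∈triangle m a) (inj₂ (anchor-triangle-endpoint m a))

  anchor-injective : ∀ {m a a′} → anchor m a ≡ anchor m a′ → a ≡ a′
  anchor-injective {m} {a} {a′} P≡P′ with a Fin.≟ a′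
  ... | yes a≡a′ = a≡a′
  ... | no a≢a′ = ⊥-elim (not-adjacent (endpoint-contact⇒adjacent triangles-≢ (anchor∈triangle m a)
                    (subst (_∈ₛ seg (tri m a′ zero)) (sym P≡P′) (anchor∈triangle m a′))
                    (inj₁ (anchor-triangle-endpoint m a))))
    where
    triangles-≢ : tri m a zero ≢ tri m a′ zero
    triangles-≢ refl = a≢a′ refl
    not-adjacent : ¬ F4Adj k t (tri m a zero) (tri m a′ zero)
    not-adjacent (_ , _ , 0≢0) = 0≢0 refl

  contact-≢-anchor : ∀ n m a → contact n ≢ anchor m a
  contact-≢-anchor n m a g≡P = C-≢-suc n (cong cyc (trans
    (anchor-on-cycle (subst (_∈ₛ _) g≡P (contact∈suc n)))
    (sym (anchor-on-cycle (subst (_∈ₛ _) g≡P (contact∈ n))))))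

  contact-≢-next : ∀ n → contact n ≢ contact (suc n)
  contact-≢-next n g≡g′
    with shared-point⇒adjacent (≢-sym (C-≢ 2 n z<s (s<s (s<s z<s))))
           (contact∈ n) (subst (_∈ₛ seg (C (suc (suc n)))) (sym g≡g′) (contact∈suc (suc n)))
  ... | inj₁ forward = C-≢-suc (suc n) (cong cyc (trans (CycSucc⇒≡ forward) (suc-mod n)))
  ... | inj₂ backward = C-≢ 3 n z<s (s<s (s<s (s<s z<s)))
                          (cong cyc (sym (trans (CycSucc⇒≡ backward) (suc-mod (suc (suc n))))))

  anchored : ∀ {m g g′} → 1 ≤ t m → g ≢ g′ → (∀ a → g ≢ anchor m a) → (∀ a → g′ ≢ anchor m a)
           → IsEndpoint g (seg (cyc m)) → ¬ IsEndpoint g′ (seg (cyc m))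
  anchored {m} 1≤t g≢g′ g≢P g′≢P g-end =
    no-three-endpoints {s = seg (cyc m)} (g≢P a) g≢g′ (≢-sym (g′≢P a)) g-end (anchor-endpoint m a)
    where
    a : Fin (t m)
    a = fromℕ< 1≤t

  doubly-anchored : ∀ {m g} → 2 ≤ t m → (∀ a → g ≢ anchor m a) → ¬ IsEndpoint g (seg (cyc m))
  doubly-anchored {m} 2≤t g≢P =
    no-three-endpoints {s = seg (cyc m)} P₀≢P₁ (≢-sym (g≢P a₀)) (≢-sym (g≢P a₁))
      (anchor-endpoint m a₀) (anchor-endpoint m a₁)
    where
    a₀ a₁ : Fin (t m)
    a₀ = fromℕ< (<-trans z<s 2≤t)
    a₁ = fromℕ< 2≤t
    P₀≢P₁ : anchor m a₀ ≢ anchor m a₁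
    P₀≢P₁ P₀≡P₁ = 0≢1+n (trans (sym (toℕ-fromℕ< _))
                            (trans (cong toℕ (anchor-injective P₀≡P₁)) (toℕ-fromℕ< _)))

  parallel⇒out×in : ∀ n → orientation (seg (C n)) ≡ orientation (seg (C (suc n))) → Out n × In n
  parallel⇒out×in n parallel with proj₂ (proj₂ (proj₂ (edge-contact n)))
  ... | inj₁ out = out , parallel-shared-endpoint (disjoint (C (suc n)) (C n) (C-≢-suc n))
                           (sym parallel) (contact∈suc n) (contact∈ n) out
  ... | inj₂ in′ = parallel-shared-endpoint (disjoint (C n) (C (suc n)) (≢-sym (C-≢-suc n))) parallel
                     (contact∈ n) (contact∈suc n) in′ , in′

  orientation-at : Fin k → Bool
  orientation-at i = orientation (seg (cyc i))

  constraints : EndpointConstraints (λ n → t (n mod k)) (λ n → orientation-at (n mod k)) Out In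
  constraints = record
    { out-or-in       = λ n → proj₂ (proj₂ (proj₂ (edge-contact n)))
    ; parallel⇒out×in = parallel⇒out×in
    ; two⇒¬out        = λ n 2≤t → doubly-anchored 2≤t (contact-≢-anchor n _)
    ; two⇒¬in         = λ n 2≤t → doubly-anchored 2≤t (contact-≢-anchor n _)
    ; one⇒¬in×out     = λ n 1≤t → anchored 1≤t (contact-≢-next n)
                                     (contact-≢-anchor n _) (contact-≢-anchor (suc n) _)
    }

lemma15 : (k : ℕ) .{{_ : NonZero k}} (t : Fin k → ℕ)
        → InF4 k t → ¬ ContactB0VPG (F4Vertex k t) (F4Adj k t)
lemma15 k t hF4 rep = odd-cycle-cannot-turn-everywhere {o = orientation-at} constraints
  where
  open OddCycleOfStretches k t hF4
  open Realisation k t (proj₁ hF4) rep
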